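{- Let $\rho$ be a code retrieving function, $C$ a state predicate, $p,q$ terms and $i,j$ labels such that (1) $\rho\,i=\mathbf{cjump}\,\overline C\,j\,(p;\mathbf{jump}\,i)$, (2) $\rho\,j=q$. Then $\rho,\rho\models\mathbf{while}\,C\,p\,q\approx\mathbf{cjump}\,\overline C\,j\,(p;\mathbf{jump}\,i)$ (mutual correspondence w.r.t. the identity relation on states).
   Context: Program terms over a state type $\alpha$ are generated by $p::=\mathbf{skip}\mid\mathbf{basic}\,f\mid\mathbf{cjump}\,C\,i\,p\mid\mathbf{while}\,C\,p\,p\mid\mathbf{if}\,C\,p\,p\mid p;p\mid\Vert(p_1,\dots,p_m)\mid\mathbf{await}\,C\,p$ ($f:\alpha\to\alpha$, $C\subseteq\alpha$, $i\in\mathbb N$, $m\ge1$). $\overline C$ is the complement of $C$; $\mathbf{jump}\,i$ abbreviates $\mathbf{cjump}\,\alpha\,i\,\mathbf{skip}$. A code retrieving function $\rho$ maps $\mathbb N$ to terms. The program step relation $\rho\vdash(p,\sigma)\to_{\mathcal P}(p',\sigma')$ is the least relation with: $(\mathbf{basic}\,f,\sigma)\to(\mathbf{skip},f\sigma)$; $(\mathbf{cjump}\,C\,i\,p,\sigma)\to(\rho\,i,\sigma)$ if $\sigma\in C$, $\to(p,\sigma)$ otherwise; $(\mathbf{await}\,C\,p,\sigma)\to(\mathbf{skip},\sigma')$ if $\sigma\in C$ and $(p,\sigma)\to^*(\mathbf{skip},\sigma')$; $(\mathbf{if}\,C\,p_1\,p_2,\sigma)\to(p_1,\sigma)$ if $\sigma\in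 C$, $\to(p_2,\sigma)$ otherwise; for $x=\mathbf{while}\,C\,p_1\,p_2$: $(x,\sigma)\to(p_1;(\mathbf{skip};x),\sigma)$ if $\sigma\in C$, $\to(p_2,\sigma)$ otherwise; $(p_1;p_2,\sigma)\to(p_1';p_2,\sigma')$ if $(p_1,\sigma)\to(p_1',\sigma')$; $(\mathbf{skip};p,\sigma)\to(p,\sigma)$; $(\Vert(\dots,p_i,\dots),\sigma)\to(\Vert(\dots,p_i',\dots),\sigma')$ if $(p_i,\sigma)\to(p_i',\sigma')$; $(\Vert(\mathbf{skip},\dots,\mathbf{skip}),\sigma)\to(\mathbf{skip},\sigma)$. A relation $X$ between terms is a simulation w.r.t. $\rho,\rho'$ and the identity on states if (i) whenever $(p,q)\in X$ and $\rho'\vdash(q,\sigma)\to_{\mathcal P}(q',\sigma')$, there is a step $\rho\vdash(p,\sigma)\to_{\mathcal P}(p',\sigma')$ with $(p',q')\in X$; (ii) $(\mathbf{skip},q)\in X\Rightarrow q=\mathbf{skip}$; (iii) $(p,\mathbf{skip})\in X\Rightarrow p=\mathbf{skip}$. $\rho,\rho'\models p\sqsupseteq q$ means some such simulation contains $(p,q)$; $\rho,\rho\models p\approx q$ means both $\rho,\rho\models p\sqsupseteq q$ and $\rho,\rho\models q\sqsupseteq p$. -}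

module Defs where

open import Data.Nat using (ℕ; suc)
open import Data.Fin using (Fin)
open import Data.Vec using (Vec; lookup; _[_]≔_)
open import Data.Vec.Relation.Unary.All using (All)
open import Data.Product using (_×_; Σ; ∃; _,_)
open import Relation.Binary.PropositionalEquality using (_≡_)
open import Relation.Nullary using (¬_)
open import Data.Bool using (Bool; true; false; not)

Pred : Set → Set
Pred α = α → Bool

_∈_ : {α : Set} → α → Pred α → Set
σ ∈ C = C σ ≡ true

∁ : {α : Set} → Pred α → Pred α
∁ C σ = not (C σ)

Univ : {α : Set} → Pred α
Univ _ = true

-- Program terms.  Parallel composition ∥(p₁,…,pₘ) with m ≥ 1 is
-- represented by a vector of length suc n.
data Term (α : Set) : Set₁ where
  skip  : Term α
  basic : (α → α) → Term α
  cjump : Pred α → ℕ → Term α → Term α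
  while : Pred α → Term α → Term α → Term α
  if    : Pred α → Term α → Term α → Term α
  _⨾_   : Term α → Term α → Term α
  par   : {n : ℕ} → Vec (Term α) (suc n) → Term α
  await : Pred α → Term α → Term α

infixr 5 _⨾_

jump : {α : Set} → ℕ → Term α
jump i = cjump Univ i skip

CodeFun : Set → Set₁
CodeFun α = ℕ → Term α

mutual
  data Step {α : Set} (ρ : CodeFun α) : Term α × α → Term α × α → Set₁ where
    basic-step : ∀ {f σ} → Step ρ (basic f , σ) (skip , f σ)
    cjump-T : ∀ {C i p σ} → σ ∈ C → Step ρ (cjump C i p , σ) (ρ i , σ)
    cjump-F : ∀ {C i p σ} → ¬ (σ ∈ C) → Step ρ (cjump C i p , σ) (p , σ)
    await-step : ∀ {C p σ σ'} → σ ∈ C → Steps ρ (p , σ) (skip , σ') →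
                 Step ρ (await C p , σ) (skip , σ')
    if-T : ∀ {C p₁ p₂ σ} → σ ∈ C → Step ρ (if C p₁ p₂ , σ) (p₁ , σ)
    if-F : ∀ {C p₁ p₂ σ} → ¬ (σ ∈ C) → Step ρ (if C p₁ p₂ , σ) (p₂ , σ)
    while-T : ∀ {C p₁ p₂ σ} → σ ∈ C →
              Step ρ (while C p₁ p₂ , σ) (p₁ ⨾ (skip ⨾ while C p₁ p₂) , σ)
    while-F : ∀ {C p₁ p₂ σ} → ¬ (σ ∈ C) → Step ρ (while C p₁ p₂ , σ) (p₂ , σ)
    seq-step : ∀ {p₁ p₁' p₂ σ σ'} → Step ρ (p₁ , σ) (p₁' , σ') →
               Step ρ (p₁ ⨾ p₂ , σ) (p₁' ⨾ p₂ , σ')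
    seq-skip : ∀ {p σ} → Step ρ (skip ⨾ p , σ) (p , σ)
    par-step : ∀ {n} {ps : Vec (Term α) (suc n)} (k : Fin (suc n)) {p' σ σ'} →
               Step ρ (lookup ps k , σ) (p' , σ') →
               Step ρ (par ps , σ) (par (ps [ k ]≔ p') , σ')
    par-skip : ∀ {n} {ps : Vec (Term α) (suc n)} {σ} → All (_≡ skip) ps →
               Step ρ (par ps , σ) (skip , σ)

  data Steps {α : Set} (ρ : CodeFun α) : Term α × α → Term α × α → Set₁ where
    refl* : ∀ {c} → Steps ρ c c
    step* : ∀ {c c' c''} → Step ρ c c' → Steps ρ c' c'' → Steps ρ c c''

-- X is a simulation w.r.t. ρ, ρ' and the identity relation on states
record IsSimulation {α : Set} (ρ ρ' : CodeFun α) (X : Term α → Term α → Set₁) : Set₁ where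
  field
    sim : ∀ {p q σ q' σ'} → X p q → Step ρ' (q , σ) (q' , σ') →
          Σ (Term α) λ p' → Step ρ (p , σ) (p' , σ') × X p' q'
    skipˡ : ∀ {q} → X skip q → q ≡ skip
    skipʳ : ∀ {p} → X p skip → p ≡ skip

_,_⊨_⊒_ : {α : Set} → CodeFun α → CodeFun α → Term α → Term α → Set₂
ρ , ρ' ⊨ p ⊒ q = ∃ λ (X : _ → _ → Set₁) → IsSimulation ρ ρ' X × X p q

_⊨_≈_ : {α : Set} → CodeFun α → Term α → Term α → Set₂
ρ ⊨ p ≈ q = (ρ , ρ ⊨ p ⊒ q) × (ρ , ρ ⊨ q ⊒ p)

module Submission where

-- Unfold the loop once: the label i holds the test
-- "if ¬C jump to the exit code j (= q), else run p and jump back to i".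
-- The configurations of  while C p q  and of  J = cjump ∁C j (p ⨾ jump i)
-- correspond as follows:
--     while C p q        ~  J                 (loop head / label i)
--     r ⨾ (skip ⨾ while) ~  r ⨾ jump i        (inside the body)
--     skip ⨾ while       ~  jump i            (body finished, back edge)
--     r                  ~  r                 (after leaving the loop)
-- Each step of one side is matched by exactly one step of the other side
-- with the same state change, the back edge  jump i  landing in  ρ i = J.
-- Hence this relation is a simulation in both directions (read forwards
-- and backwards), which gives mutual correspondence.

open import Defs
open import Data.Nat using (ℕ)
open import Data.Bool using (true; false)
open import Data.Product using (Σ; _,_; _×_)
open import Data.Empty using (⊥-elim)
open import Function using (flip)
open import Relation.Nullary using (¬_)
open import Relation.Binary.PropositionalEquality using (_≡_; refl; subst; sym)

-- The predicate C is explicit: it cannot be inferred from the Bool value  C σ.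
module _ {α : Set} (C : Pred α) {σ : α} where

  ∈∁⇒∉ : σ ∈ ∁ C → ¬ (σ ∈ C)
  ∈∁⇒∉ σ∈∁C σ∈C rewrite σ∈C with σ∈∁C
  ... | ()

  ∉⇒∈∁ : ¬ (σ ∈ C) → σ ∈ ∁ C
  ∉⇒∈∁ σ∉C with C σ
  ... | true  = ⊥-elim (σ∉C refl)
  ... | false = refl

  ∈⇒∉∁ : σ ∈ C → ¬ (σ ∈ ∁ C)
  ∈⇒∉∁ σ∈C σ∈∁C = ∈∁⇒∉ σ∈∁C σ∈C

  ∉∁⇒∈ : ¬ (σ ∈ ∁ C) → σ ∈ C
  ∉∁⇒∈ σ∉∁C with C σ
  ... | true  = refl
  ... | false = ⊥-elim (σ∉∁C refl)

≈-intro : {α : Set} {ρ : CodeFun α} {p q : Term α} (X : Term α → Term α → Set₁) →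
          IsSimulation ρ ρ X → IsSimulation ρ ρ (flip X) → X p q → ρ ⊨ p ≈ q
≈-intro X forward backward pXq = (X , forward , pXq) , (flip X , backward , pXq)

module WhileAsJump {α : Set} (ρ : CodeFun α) (C : Pred α) (p q : Term α) (i j : ℕ)
  (code-i : ρ i ≡ cjump (∁ C) j (p ⨾ jump i)) (code-j : ρ j ≡ q) where

  loop : Term α
  loop = while C p q

  jumps : Term α
  jumps = cjump (∁ C) j (p ⨾ jump i)

  data Corr : Term α → Term α → Set₁ where
    head : Corr loop jumps
    body : ∀ r → Corr (r ⨾ (skip ⨾ loop)) (r ⨾ jump i)
    back : Corr (skip ⨾ loop) (jump i)
    same : ∀ r → Corr r r

  head-at-i : Corr loop (ρ i)
  head-at-i = subst (Corr loop) (sym code-i) head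

  exit-at-j : Corr q (ρ j)
  exit-at-j = subst (Corr q) (sym code-j) (same q)

  skip-left : ∀ {b} → Corr skip b → b ≡ skip
  skip-left (same _) = refl

  skip-right : ∀ {a} → Corr a skip → a ≡ skip
  skip-right (same _) = refl

  loop-simulates : ∀ {a b σ b' σ'} → Corr a b → Step ρ (b , σ) (b' , σ') →
                   Σ (Term α) λ a' → Step ρ (a , σ) (a' , σ') × Corr a' b'
  loop-simulates head     (cjump-T σ∈∁C) = q , while-F (∈∁⇒∉ C σ∈∁C) , exit-at-j
  loop-simulates head     (cjump-F σ∉∁C) = _ , while-T (∉∁⇒∈ C σ∉∁C) , body p
  loop-simulates (body r) (seq-step s)   = _ , seq-step s , body _
  loop-simulates (body _) seq-skip       = _ , seq-skip , back
  loop-simulates back     (cjump-T _)    = _ , seq-skip , head-at-i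
  loop-simulates back     (cjump-F σ∉U)  = ⊥-elim (σ∉U refl)
  loop-simulates (same r) s              = _ , s , same _

  jumps-simulate : ∀ {a b σ a' σ'} → Corr a b → Step ρ (a , σ) (a' , σ') →
                   Σ (Term α) λ b' → Step ρ (b , σ) (b' , σ') × Corr a' b'
  jumps-simulate head     (while-T σ∈C) = _ , cjump-F (∈⇒∉∁ C σ∈C) , body p
  jumps-simulate head     (while-F σ∉C) = _ , cjump-T (∉⇒∈∁ C σ∉C) , exit-at-j
  jumps-simulate (body r) (seq-step s)  = _ , seq-step s , body _
  jumps-simulate (body _) seq-skip      = _ , seq-skip , back
  jumps-simulate back     seq-skip      = _ , cjump-T refl , head-at-i
  jumps-simulate back     (seq-step ())
  jumps-simulate (same r) s             = _ , s , same _

  correspondence : ρ ⊨ loop ≈ jumps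
  correspondence = ≈-intro Corr
    record { sim = loop-simulates ; skipˡ = skip-left ; skipʳ = skip-right }
    record { sim = jumps-simulate ; skipˡ = skip-right ; skipʳ = skip-left }
    head

mainTheorem10 : {α : Set} (ρ : CodeFun α) (C : Pred α) (p q : Term α) (i j : ℕ) →
    ρ i ≡ cjump (∁ C) j (p ⨾ jump i) →
    ρ j ≡ q →
    ρ ⊨ while C p q ≈ cjump (∁ C) j (p ⨾ jump i)
mainTheorem10 ρ C p q i j code-i code-j =
  WhileAsJump.correspondence ρ C p q i j code-i code-j
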